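{- Let $(S,\mathit{Tr},\mathrm{source},\mathrm{target},\ell,\smile^{\bullet})$ be a labelled transition system with concurrency, and let $B$ be a set of actions with $\mathit{Rec}\subseteq B\subseteq \mathit{Act}$. Suppose that for every state $s\in S$ only countably many transitions $t\in \mathit{Tr}^\bullet_{\neg B}$ satisfy $\mathrm{source}(t)=s$. Then $B$-justness is feasible: every finite path is a prefix of some $B$-just path.
   Context: A labelled transition system (LTS) is a tuple $(S,\mathit{Tr},\mathrm{source},\mathrm{target},\ell)$ with $S$ a set of states, $\mathit{Tr}$ a set of transitions, $\mathrm{source},\mathrm{target}:\mathit{Tr}\to S$ and $\ell:\mathit{Tr}\to\mathit{Lab}$, where the label set comes with subsets $\mathit{Rec}\subseteq\mathit{Act}\subseteq\mathit{Lab}$ (actions and receptive actions). Transitions $t$ with $\ell(t)\notin\mathit{Act}$ are called indicator transitions. Let $\mathit{Tr}^\bullet=\{t\in\mathit{Tr}\mid \ell(t)\in\mathit{Act}\setminus\mathit{Rec}\}$ and, for $\mathit{Rec}\subseteq B\subseteq\mathit{Act}$, $\mathit{Tr}^\bullet_{\neg B}=\{t\in\mathit{Tr}^\bullet\mid \ell(t)\notin B\}$. A path is an alternating sequence $s_0\,t_1\,s_1\,t_2\,s_2\cdots$ of states and non-indicator transitions, starting with a state and either infinite or ending with a state, with $\mathrm{source}(t_i)=s_{i-1}$ and $\mathrm{target}(t_i)=s_i$. An LTS with concurrency (LTSC) is an LTS together with a relation $\smile^{\bullet}\subseteq\mathit{Tr}^\bullet\times\mathit{Tr}$ such that (1) $t\not\smile^{\bullet}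 t$ for all $t\in\mathit{Tr}^\bullet$, and (2) if $t\in\mathit{Tr}^\bullet$ and $\pi$ is a path from $\mathrm{source}(t)$ to a state $s$ such that $t\smile^{\bullet} v$ for all transitions $v$ occurring in $\pi$, then there is $u\in\mathit{Tr}^\bullet$ with $\mathrm{source}(u)=s$, $\ell(u)=\ell(t)$ and $t\not\smile^{\bullet} u$. A path $\pi$ is $B$-just if for each suffix $\pi'$ of $\pi$ and each $t\in\mathit{Tr}^\bullet_{\neg B}$ whose source is the first state of $\pi'$, some transition $u$ with $t\not\smile^{\bullet}u$ occurs in $\pi'$. -}

module Defs where

open import Level using (0ℓ)
open import Data.Nat using (ℕ; zero; suc)
open import Data.Fin using (Fin; toℕ)
open import Data.List using (List; []; _∷_; length; lookup)
open import Data.List.Relation.Unary.All using (All)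
open import Data.List.Relation.Unary.Any using (Any)
open import Data.Product using (Σ; _×_; ∃-syntax)
open import Data.Sum using (_⊎_)
open import Data.Unit using (⊤)
open import Data.Empty using (⊥)
open import Relation.Nullary using (¬_)
open import Relation.Binary.PropositionalEquality using (_≡_)

record LTS : Set₁ where
  field
    S Tr Lab : Set
    source target : Tr → S
    ℓ   : Tr → Lab
    Act : Lab → Set
    Rec : Lab → Set
    Rec⊆Act : ∀ {a} → Rec a → Act a


module LTSDefs (L : LTS) where
  open LTS L public

  Tr• : Tr → Set
  Tr• t = Act (ℓ t) × ¬ Rec (ℓ t)

  Tr•¬ : (Lab → Set) → Tr → Set
  Tr•¬ B t = Tr• t × ¬ B (ℓ t)

  IsFinPathFrom : S → List Tr → Set
  IsFinPathFrom s [] = ⊤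
  IsFinPathFrom s (t ∷ ts) = source t ≡ s × Act (ℓ t) × IsFinPathFrom (target t) ts

  end : S → List Tr → S
  end s [] = s
  end s (t ∷ ts) = end (target t) ts

  IsInfPathFrom : S → (ℕ → Tr) → Set
  IsInfPathFrom s f = (source (f 0) ≡ s) × (∀ i → source (f (suc i)) ≡ target (f i))
                      × (∀ i → Act (ℓ (f i)))

record LTSC : Set₁ where
  field
    lts : LTS
  open LTSDefs lts
  field
    _⌣_ : Tr → Tr → Set
    ⌣⊆Tr• : ∀ {t u} → t ⌣ u → Tr• t
    ⌣-irrefl : ∀ t → Tr• t → ¬ (t ⌣ t)
    ⌣-persist : ∀ t → Tr• t → ∀ (π : List Tr) → IsFinPathFrom (source t) π →
                All (λ v → t ⌣ v) π →
                ∃[ u ] (Tr• u × source u ≡ end (source t) π × ℓ u ≡ ℓ t × ¬ (t ⌣ u))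

module LTSCDefs (L : LTSC) where
  open LTSC L public using (lts; _⌣_; ⌣⊆Tr•; ⌣-irrefl; ⌣-persist)
  open LTSDefs lts public

  data Path : Set where
    finPath : (s : S) (ts : List Tr) → IsFinPathFrom s ts → Path
    infPath : (s : S) (f : ℕ → Tr) → IsInfPathFrom s f → Path

  JustFin : (Lab → Set) → S → List Tr → Set
  JustFin B s [] = ∀ t → Tr•¬ B t → source t ≡ s → ⊥
  JustFin B s (v ∷ ts) =
    (∀ t → Tr•¬ B t → source t ≡ s → Any (λ u → ¬ (t ⌣ u)) (v ∷ ts))
    × JustFin B (target v) ts

  stateInf : S → (ℕ → Tr) → ℕ → S
  stateInf s f zero = s
  stateInf s f (suc k) = target (f k)

  JustInf : (Lab → Set) → S → (ℕ → Tr) → Set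
  JustInf B s f = ∀ k t → Tr•¬ B t → source t ≡ stateInf s f k →
                  ∃[ j ] (k Data.Nat.≤ j × ¬ (t ⌣ f j))

  Just : (Lab → Set) → Path → Set
  Just B (finPath s ts _) = JustFin B s ts
  Just B (infPath s f _) = JustInf B s f

  data IsPrefixOf (s : S) (ts : List Tr) : Path → Set where
    pre-fin : ∀ rest p → IsPrefixOf s ts (finPath s (ts Data.List.++ rest) p)
    pre-inf : ∀ f p → (∀ (i : Fin (length ts)) → lookup ts i ≡ f (toℕ i)) →
              IsPrefixOf s ts (infPath s f p)

  CountablyManyFrom : (Lab → Set) → S → Set
  CountablyManyFrom B s =
    Σ (Tr → ℕ) λ code → (∀ (t t' : Tr) → Tr•¬ B t → source t ≡ s → Tr•¬ B t' → source t' ≡ s →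
               code t ≡ code t' → t ≡ t')

  JustnessFeasible : (Lab → Set) → Set
  JustnessFeasible B = ∀ s ts → IsFinPathFrom s ts →
                       ∃[ π ] (Just B π × IsPrefixOf s ts π)

module Submission where

-- Call t ∈ Tr•¬B a pending obligation of a finite path at position k if t leaves the k-th state and is
-- concurrent with every later transition.  A finite path is B-just iff nothing is pending, and by axiom (2)
-- of an LTSC any pending obligation t is discharged by appending a transition u with ¬ (t ⌣ u).
-- Countability gives every obligation at a given state an injective code, so an obligation is determined
-- by its pair (position, code).  Starting from the given path we discharge obligations one step at a time,
-- step n serving the pair enumerated n-th by a diagonal enumeration of ℕ × ℕ (or any pending obligation if
-- that pair is not pending).  Either some stage has nothing pending, and is a B-just finite extension, or
-- the stages grow forever; their limit is then an infinite path, and an obligation never discharged in the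
-- limit would have been pending, and served, at the step enumerating its pair.

open import Defs
open import Level using (0ℓ)
open import Axiom.ExcludedMiddle using (ExcludedMiddle)
open LTSCDefs using (Lab; Act; Rec; CountablyManyFrom; S; JustnessFeasible)

open import Data.Nat using (ℕ; zero; suc; _+_; _∸_; _≤_; z≤n; s≤s)
open import Data.Nat.Properties
  using (+-suc; +-identityʳ; ≤-trans; ≤-reflexive; n≤1+n; m≤m+n; m≤n+m; m≤n⇒m≤o+n; m+n≤o⇒m≤o)
open import Data.Fin using (Fin; toℕ)
import Data.Fin as Fin
open import Data.List using (List; []; _∷_; _++_; length; lookup; take; drop; applyUpTo)
open import Data.List.Properties using (++-assoc; ++-identityʳ; applyUpTo-∷ʳ)
open import Data.List.Relation.Unary.All using (All; [])
open import Data.List.Relation.Unary.All.Properties using (¬All⇒Any¬; applyUpTo⁺₂)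
open import Data.Product using (Σ; _×_; _,_; proj₁; proj₂; ∃-syntax)
open import Data.Unit using (tt)
open import Function using (_∘_)
open import Relation.Nullary using (¬_; yes; no; contradiction)
open import Relation.Nullary.Decidable using (decidable-stable)
open import Relation.Binary.PropositionalEquality using (_≡_; refl; sym; trans; cong; subst; module ≡-Reasoning)

open ≡-Reasoning

nextPair : ℕ × ℕ → ℕ × ℕ
nextPair (zero  , c) = (suc c , 0)
nextPair (suc a , c) = (a , suc c)

unpair : ℕ → ℕ × ℕ
unpair zero    = (0 , 0)
unpair (suc n) = nextPair (unpair n)

unpair-walk : ∀ j a c n → unpair n ≡ (j + a , c) → unpair (j + n) ≡ (a , j + c)
unpair-walk zero    a c n e = e
unpair-walk (suc j) a c n e = begin
  unpair (suc j + n)  ≡⟨ cong unpair (sym (+-suc j n)) ⟩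
  unpair (j + suc n)  ≡⟨ unpair-walk j a (suc c) (suc n) (cong nextPair e) ⟩
  (a , j + suc c)     ≡⟨ cong (a ,_) (+-suc j c) ⟩
  (a , suc j + c)     ∎

unpair-diagonal : ∀ d → ∃[ n ] unpair n ≡ (d , 0)
unpair-diagonal zero = 0 , refl
unpair-diagonal (suc d) =
  let (n , e) = unpair-diagonal d
      d-steps = unpair-walk d 0 0 n (trans e (cong (_, 0) (sym (+-identityʳ d))))
  in suc (d + n) , (begin
       nextPair (unpair (d + n))  ≡⟨ cong nextPair d-steps ⟩
       (suc (d + 0) , 0)          ≡⟨ cong (λ x → suc x , 0) (+-identityʳ d) ⟩
       (suc d , 0)                ∎)

unpair-surjective : ∀ k c → ∃[ n ] unpair n ≡ (k , c)
unpair-surjective k c =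
  let (n , e) = unpair-diagonal (c + k)
  in c + n , trans (unpair-walk c k 0 n e) (cong (k ,_) (+-identityʳ c))

nextPair-sum : ∀ p → proj₁ (nextPair p) + proj₂ (nextPair p) ≤ suc (proj₁ p + proj₂ p)
nextPair-sum (zero  , c) = s≤s (≤-reflexive (+-identityʳ c))
nextPair-sum (suc a , c) = ≤-trans (≤-reflexive (+-suc a c)) (n≤1+n _)

unpair-sum-≤ : ∀ n → proj₁ (unpair n) + proj₂ (unpair n) ≤ n
unpair-sum-≤ zero    = z≤n
unpair-sum-≤ (suc n) = ≤-trans (nextPair-sum (unpair n)) (s≤s (unpair-sum-≤ n))

-- Each pair (k , c) is enumerated, and not before step k.  This is the schedule of the construction:
-- step n attends to position k, which must already exist at that step.
schedule : ∀ k c → ∃[ n ] (unpair n ≡ (k , c) × k ≤ n)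
schedule k c =
  let (n , e) = unpair-surjective k c
  in n , e , m+n≤o⇒m≤o k (subst (λ p → proj₁ p + proj₂ p ≤ n) e (unpair-sum-≤ n))

module _ {A : Set} where

  _++ˢ_ : List A → (ℕ → A) → ℕ → A
  ([]       ++ˢ g) i       = g i
  ((x ∷ xs) ++ˢ g) zero    = x
  ((x ∷ xs) ++ˢ g) (suc i) = (xs ++ˢ g) i

  ++ˢ-lookup : ∀ xs (g : ℕ → A) (i : Fin (length xs)) → lookup xs i ≡ (xs ++ˢ g) (toℕ i)
  ++ˢ-lookup (x ∷ xs) g Fin.zero    = refl
  ++ˢ-lookup (x ∷ xs) g (Fin.suc i) = ++ˢ-lookup xs g i

  ++ˢ-after : ∀ xs (g : ℕ → A) n → (xs ++ˢ g) (length xs + n) ≡ g n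
  ++ˢ-after []       g n = refl
  ++ˢ-after (x ∷ xs) g n = ++ˢ-after xs g n

  applyUpTo-++ˢ : ∀ xs (g : ℕ → A) n → applyUpTo (xs ++ˢ g) (length xs + n) ≡ xs ++ applyUpTo g n
  applyUpTo-++ˢ []       g n = refl
  applyUpTo-++ˢ (x ∷ xs) g n = cong (x ∷_) (applyUpTo-++ˢ xs g n)

  take-applyUpTo : ∀ (f : ℕ → A) {k m} → k ≤ m → take k (applyUpTo f m) ≡ applyUpTo f k
  take-applyUpTo f z≤n      = refl
  take-applyUpTo f (s≤s le) = cong (f 0 ∷_) (take-applyUpTo (f ∘ suc) le)

  drop-applyUpTo : ∀ (f : ℕ → A) k m → drop k (applyUpTo f m) ≡ applyUpTo (λ i → f (k + i)) (m ∸ k)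
  drop-applyUpTo f zero    m       = refl
  drop-applyUpTo f (suc k) zero    = refl
  drop-applyUpTo f (suc k) (suc m) = drop-applyUpTo (f ∘ suc) k m

module Paths (L : LTS) where
  open LTSDefs L using (Tr; source; target; ℓ; IsFinPathFrom; end; IsInfPathFrom)

  path-++ : ∀ {s} xs {ys} → IsFinPathFrom s xs → IsFinPathFrom (end s xs) ys → IsFinPathFrom s (xs ++ ys)
  path-++ []       _           q = q
  path-++ (x ∷ xs) (e , a , p) q = e , a , path-++ xs p q

  path-take : ∀ k {s} ts → IsFinPathFrom s ts → IsFinPathFrom s (take k ts)
  path-take zero    ts       p           = tt
  path-take (suc k) []       p           = tt
  path-take (suc k) (t ∷ ts) (e , a , p) = e , a , path-take k ts p

  path-drop : ∀ k {s} ts → IsFinPathFrom s ts → IsFinPathFrom (end s (take k ts)) (drop k ts)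
  path-drop zero    ts       p           = p
  path-drop (suc k) []       p           = tt
  path-drop (suc k) (t ∷ ts) (_ , _ , p) = path-drop k ts p

  end-take-drop : ∀ k s ts → end (end s (take k ts)) (drop k ts) ≡ end s ts
  end-take-drop zero    s ts       = refl
  end-take-drop (suc k) s []       = refl
  end-take-drop (suc k) s (t ∷ ts) = end-take-drop k (target t) ts

  end-applyUpTo-suc : ∀ s (f : ℕ → Tr) i → end s (applyUpTo f (suc i)) ≡ target (f i)
  end-applyUpTo-suc s f zero    = refl
  end-applyUpTo-suc s f (suc i) = end-applyUpTo-suc (target (f 0)) (f ∘ suc) i

  prefix-step : ∀ i s (f : ℕ → Tr) → IsFinPathFrom s (applyUpTo f (suc i)) →
                source (f i) ≡ end s (applyUpTo f i) × LTS.Act L (ℓ (f i))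
  prefix-step zero    s f (e , a , _) = e , a
  prefix-step (suc i) s f (_ , _ , p) = prefix-step i (target (f 0)) (f ∘ suc) p

  prefixes⇒infPath : ∀ s (f : ℕ → Tr) → (∀ i → IsFinPathFrom s (applyUpTo f (suc i))) → IsInfPathFrom s f
  prefixes⇒infPath s f prefix =
    proj₁ (prefix-step 0 s f (prefix 0)) ,
    (λ i → trans (proj₁ (prefix-step (suc i) s f (prefix (suc i)))) (end-applyUpTo-suc s f i)) ,
    (λ i → proj₂ (prefix-step i s f (prefix i)))

module Obligations (lem : ExcludedMiddle 0ℓ) (L : LTSC) (B : Lab L → Set) where
  open LTSCDefs L hiding (S; Lab; Act; Rec; CountablyManyFrom; JustnessFeasible)
  open Paths lts

  record Pending (s : S L) (ts : List Tr) (k : ℕ) (t : Tr) : Set where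
    constructor pending
    field
      obligation : Tr•¬ B t
      starts     : source t ≡ end s (take k ts)
      concurrent : All (t ⌣_) (drop k ts)

  no-pending⇒just : ∀ s ts → (∀ k t → ¬ Pending s ts k t) → JustFin B s ts
  no-pending⇒just s []       free = λ t t¬B e → free 0 t (pending t¬B e [])
  no-pending⇒just s (v ∷ ts) free =
    (λ t t¬B e → ¬All⇒Any¬ (λ _ → lem) (v ∷ ts) (λ concurrent → free 0 t (pending t¬B e concurrent))) ,
    no-pending⇒just (target v) ts (λ { k t (pending o e c) → free (suc k) t (pending o e c) })

  discharge : ∀ {s ts k t} → IsFinPathFrom s ts → Pending s ts k t →
              ∃[ u ] (IsFinPathFrom s (ts ++ u ∷ []) × ¬ (t ⌣ u))
  discharge {s} {ts} {k} {t} p (pending (t• , _) e concurrent) =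
    let (u , u• , u-source , _ , t⌣̸u) = ⌣-persist t t• (drop k ts) remainder concurrent
    in u , path-++ ts p (trans u-source remainder-end , proj₁ u• , tt) , t⌣̸u
    where
    remainder : IsFinPathFrom (source t) (drop k ts)
    remainder = subst (λ σ → IsFinPathFrom σ (drop k ts)) (sym e) (path-drop k ts p)

    remainder-end : end (source t) (drop k ts) ≡ end s ts
    remainder-end = trans (cong (λ σ → end σ (drop k ts)) e) (end-take-drop k s ts)

  end-applyUpTo : ∀ s f k → end s (applyUpTo f k) ≡ stateInf s f k
  end-applyUpTo s f zero    = refl
  end-applyUpTo s f (suc k) = end-applyUpTo-suc s f k

  sequence-pending : ∀ {s f k m t} → k ≤ m → Tr•¬ B t → source t ≡ stateInf s f k →
                     (∀ j → k ≤ j → t ⌣ f j) → Pending s (applyUpTo f m) k t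
  sequence-pending {s} {f} {k} {m} {t} k≤m t¬B e later =
    pending t¬B
    (begin
      source t                         ≡⟨ e ⟩
      stateInf s f k                   ≡⟨ sym (end-applyUpTo s f k) ⟩
      end s (applyUpTo f k)            ≡⟨ cong (end s) (sym (take-applyUpTo f k≤m)) ⟩
      end s (take k (applyUpTo f m))   ∎)
    (subst (All (t ⌣_)) (sym (drop-applyUpTo f k m))
      (applyUpTo⁺₂ _ (m ∸ k) (λ i → later (k + i) (m≤m+n k i))))

module Construction (lem : ExcludedMiddle 0ℓ) (L : LTSC) (B : Lab L → Set)
                    (countable : ∀ s → CountablyManyFrom L B s) where
  open LTSCDefs L hiding (S; Lab; Act; Rec; CountablyManyFrom; JustnessFeasible)
  open Paths lts
  open Obligations lem L B

  code : Tr → ℕ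
  code t = proj₁ (countable (source t)) t

  code-injective : ∀ {t t'} → Tr•¬ B t → Tr•¬ B t' → source t ≡ source t' → code t ≡ code t' → t ≡ t'
  code-injective {t} {t'} t¬B t'¬B e c =
    proj₂ (countable (source t)) t t' t¬B refl t'¬B (sym e)
      (trans c (cong (λ σ → proj₁ (countable σ) t') (sym e)))

  module FromPath (s₀ : S L) (ts₀ : List Tr) (p₀ : IsFinPathFrom s₀ ts₀) where

    AnyPending : List Tr → Set
    AnyPending ts = ∃[ k ] ∃[ t ] Pending s₀ ts k t

    Scheduled : ℕ × ℕ → List Tr → Tr → Set
    Scheduled kc ts t = Pending s₀ ts (proj₁ kc) t × code t ≡ proj₂ kc

    -- Two obligations at the same position leave the same state, so equal codes make them equal.
    scheduled-unique : ∀ {kc ts t t'} → Scheduled kc ts t → Scheduled kc ts t' → t ≡ t'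
    scheduled-unique (pending t¬B e _ , c) (pending t'¬B e' _ , c') =
      code-injective t¬B t'¬B (trans e (sym e')) (trans c (sym c'))

    Serves : ℕ → List Tr → Tr → Set
    Serves n ts u = ∀ t → Scheduled (unpair n) ts t → ¬ (t ⌣ u)

    Stage : Set
    Stage = Σ (List Tr) (IsFinPathFrom s₀)

    data Step (n : ℕ) (ts : List Tr) : Set where
      done   : ¬ AnyPending ts → Step n ts
      extend : (u : Tr) → IsFinPathFrom s₀ (ts ++ u ∷ []) → Serves n ts u → Step n ts

    step : ∀ n (st : Stage) → Step n (proj₁ st)
    step n (ts , p) with lem {∃[ t ] Scheduled (unpair n) ts t}
    ... | yes (t , scheduled) =
      let (u , p' , t⌣̸u) = discharge p (proj₁ scheduled)
      in extend u p' (λ t' scheduled' →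
           subst (λ x → ¬ (x ⌣ u)) (scheduled-unique {kc = unpair n} scheduled scheduled') t⌣̸u)
    ... | no nothing-scheduled with lem {AnyPending ts}
    ...   | yes (k , t , pending-t) =
      let (u , p' , _) = discharge p pending-t
      in extend u p' (λ t' scheduled' → contradiction (t' , scheduled') nothing-scheduled)
    ...   | no nothing-pending = done nothing-pending

    next : ∀ n (st : Stage) → Step n (proj₁ st) → Stage
    next n st       (done _)       = st
    next n (ts , _) (extend u p _) = ts ++ u ∷ [] , p

    stage : ℕ → Stage
    stage zero    = ts₀ , p₀
    stage (suc n) = next n (stage n) (step n (stage n))

    trace : ℕ → List Tr
    trace n = proj₁ (stage n)

    next-extends : ∀ n st (r : Step n (proj₁ st)) → ∃[ rest ] proj₁ (next n st r) ≡ proj₁ st ++ rest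
    next-extends n st       (done _)       = [] , sym (++-identityʳ (proj₁ st))
    next-extends n (ts , _) (extend u _ _) = u ∷ [] , refl

    stage-extends : ∀ n → ∃[ rest ] trace n ≡ ts₀ ++ rest
    stage-extends zero    = [] , sym (++-identityʳ ts₀)
    stage-extends (suc n) =
      let (rest , e) = stage-extends n
          (rest' , e') = next-extends n (stage n) (step n (stage n))
      in rest ++ rest' , trans e' (trans (cong (_++ rest') e) (++-assoc ts₀ rest rest'))

    finite-extension : ∀ {ts} (p : IsFinPathFrom s₀ ts) → ∃[ rest ] ts ≡ ts₀ ++ rest → JustFin B s₀ ts →
                       ∃[ π ] (Just B π × IsPrefixOf s₀ ts₀ π)
    finite-extension p (rest , refl) just = finPath s₀ _ p , just , pre-fin rest p

    next-grows : ∀ n st (r : Step n (proj₁ st)) → ¬ ¬ AnyPending (proj₁ st) →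
                 ∃[ u ] (proj₁ (next n st r) ≡ proj₁ st ++ u ∷ [] × Serves n (proj₁ st) u)
    next-grows n st       (done none)         some-pending = contradiction none some-pending
    next-grows n (ts , _) (extend u _ serves) _            = u , refl , serves

    module Forever (never-done : ∀ n → ¬ ¬ AnyPending (trace n)) where

      growth : ∀ n → ∃[ u ] (trace (suc n) ≡ trace n ++ u ∷ [] × Serves n (trace n) u)
      growth n = next-grows n (stage n) (step n (stage n)) (never-done n)

      appended : ℕ → Tr
      appended n = proj₁ (growth n)

      limit : ℕ → Tr
      limit = ts₀ ++ˢ appended

      trace-appended : ∀ n → trace n ≡ ts₀ ++ applyUpTo appended n
      trace-appended zero    = sym (++-identityʳ ts₀)
      trace-appended (suc n) = begin
        trace (suc n)
          ≡⟨ proj₁ (proj₂ (growth n)) ⟩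
        trace n ++ appended n ∷ []
          ≡⟨ cong (_++ appended n ∷ []) (trace-appended n) ⟩
        (ts₀ ++ applyUpTo appended n) ++ appended n ∷ []
          ≡⟨ ++-assoc ts₀ _ _ ⟩
        ts₀ ++ (applyUpTo appended n ++ appended n ∷ [])
          ≡⟨ cong (ts₀ ++_) (applyUpTo-∷ʳ appended n) ⟩
        ts₀ ++ applyUpTo appended (suc n)
          ∎

      trace-limit : ∀ n → trace n ≡ applyUpTo limit (length ts₀ + n)
      trace-limit n = trans (trace-appended n) (sym (applyUpTo-++ˢ ts₀ appended n))

      -- Its prefixes are prefixes of stages, hence paths from s₀.
      limit-path : IsInfPathFrom s₀ limit
      limit-path = prefixes⇒infPath s₀ limit λ i →
        subst (IsFinPathFrom s₀) (take-applyUpTo limit (m≤n+m (suc i) (length ts₀)))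
          (path-take (suc i) _ (subst (IsFinPathFrom s₀) (trace-limit (suc i)) (proj₂ (stage (suc i)))))

      -- An obligation t at position k that the limit never discharges would be pending, with
      -- position k and code (code t), at the step n scheduling that pair; that step serves it.
      limit-just : JustInf B s₀ limit
      limit-just k t t¬B e = decidable-stable lem λ never-discharged →
        let (n , scheduled-at-n , k≤n) = schedule k (code t)
            k≤M = m≤n⇒m≤o+n (length ts₀) k≤n
            later : ∀ j → k ≤ j → t ⌣ limit j
            later j k≤j = decidable-stable lem λ t⌣̸ → never-discharged (j , k≤j , t⌣̸)
            pending-t : Pending s₀ (trace n) k t
            pending-t = subst (λ ts → Pending s₀ ts k t) (sym (trace-limit n)) (sequence-pending k≤M t¬B e later)
            scheduled : Scheduled (unpair n) (trace n) t
            scheduled = subst (λ kc → Scheduled kc (trace n) t) (sym scheduled-at-n) (pending-t , refl)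
        in proj₂ (proj₂ (growth n)) t scheduled
             (subst (t ⌣_) (++ˢ-after ts₀ appended n) (later (length ts₀ + n) k≤M))

    extension : ∃[ π ] (Just B π × IsPrefixOf s₀ ts₀ π)
    extension with lem {∃[ n ] ¬ AnyPending (trace n)}
    ... | yes (n , none) =
      finite-extension (proj₂ (stage n)) (stage-extends n)
        (no-pending⇒just s₀ (trace n) λ k t pending-t → none (k , t , pending-t))
    ... | no never-done =
      infPath s₀ limit limit-path , limit-just , pre-inf limit limit-path (++ˢ-lookup ts₀ appended)
      where open Forever (λ n none → never-done (n , none))

theorem1 : ExcludedMiddle 0ℓ → (L : LTSC) → (B : Lab L → Set) →
           (∀ a → Rec L a → B a) → (∀ a → B a → Act L a) →
           (∀ (s : S L) → CountablyManyFrom L B s) →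
           JustnessFeasible L B
theorem1 lem L B _ _ countable s ts p = Construction.FromPath.extension lem L B countable s ts p
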